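{- Let $p$ be a prime and $m\ge2$ an integer. Then \[ \min_{2\le s\le m}\frac{\operatorname{ord}_p\left(\binom{m}{s}/m\right)}{s-1}=\begin{cases}0&\text{if }p\nmid m,\\-\frac{1}{p-1}&\text{if }p\mid m.\end{cases} \] If $p\nmid m$ the minimum is attained at $s=m$; if $p\mid m$ it is attained at $s=p$.
   Context: $\operatorname{ord}_p$ denotes the $p$-adic valuation on $\mathbb{Q}$. -}

module Defs where

open import Data.Nat using (ℕ; zero; suc; _/_)
open import Data.Nat.Divisibility using (_∣?_)
open import Data.Integer using (ℤ; +_; ∣_∣; _-_)
open import Data.Rational using (ℚ; ↥_; ↧ₙ_; 0ℚ)
import Data.Rational as ℚ
open import Relation.Nullary using (yes; no)

-- multiplicity of p in n, computed with fuel (fuel n suffices for p ≥ 2, n ≥ 1)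
ordFuel : ℕ → ℕ → ℕ → ℕ
ordFuel zero    p               n = 0
ordFuel (suc f) zero            n = 0
ordFuel (suc f) (suc zero)      n = 0
ordFuel (suc f) p@(suc (suc q)) n with p ∣? n
... | yes _ = suc (ordFuel f p (n / p))
... | no  _ = 0

ordℕ : ℕ → ℕ → ℕ
ordℕ p n = ordFuel n p n

-- p-adic valuation on ℚ (reduced form a/b: ord_p|a| - ord_p b); ord_p 0 := 0 (junk, unused)
ord : ℕ → ℚ → ℤ
ord p q = + ordℕ p ∣ ↥ q ∣ - + ordℕ p (↧ₙ q)

-- total division of an integer by a natural, as a rational (x /' 0 := 0, unused)
_/'_ : ℤ → ℕ → ℚ
x /' zero  = 0ℚ
x /' suc n = x ℚ./ suc n

module Submission where

-- The argument rests on the absorption identity s·C(m,s) = m·C(m-1,s-1),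
-- which together with additivity of ord_p gives
--     ord_p (C(m,s)/m) = ord_p C(m-1,s-1) - ord_p s ≥ - ord_p s,
-- and on the Bernoulli-type bound ord_p(s)·(p-1) + 1 ≤ p^ord_p(s) ≤ s,
-- so that ord_p (C(m,s)/m) / (s-1) ≥ -1/(p-1).  If p ∤ m the quotient
-- C(m,s)/m has no p in its denominator, hence nonnegative valuation, and
-- C(m,m)/m = 1/m has valuation 0.  If p ∣ m then C(m-1,p-1)·(p-1)! is the
-- falling factorial (m-1)(m-2)⋯(m-p+1), none of whose factors is divisible
-- by p, so ord_p (C(m,p)/m) = 0 - ord_p p = -1.

open import Defs
open import Data.Nat using (ℕ; _≤_; _∸_)
open import Data.Nat.Primality using (Prime)
open import Data.Nat.Divisibility using (_∣_)
open import Data.Nat.Combinatorics using (_C_)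
open import Data.Integer using (+_)
open import Data.Rational using (ℚ; 0ℚ; -_)
import Data.Rational as ℚ
open import Data.Product using (_×_)
open import Relation.Nullary using (¬_)
open import Relation.Binary.PropositionalEquality using (_≡_)

open import Data.Nat.Base using (zero; suc; _+_; _*_; _^_; _<_; _/_; _!; z≤n; s≤s; NonZero; >-nonZero; nonTrivial⇒n>1; z<s)
open import Data.Nat.Properties
open import Data.Nat.Divisibility using (divides; _∣?_; ∣1⇒≡1; ∣⇒≤; ∣m+n∣m⇒∣n; ∣m⇒∣m*n)
open import Data.Nat.DivMod using (m/n*n≡m; m*n/n≡m)
open import Data.Nat.Combinatorics using (nCk≡nPk/k!; nCn≡1)
open import Data.Nat.Combinatorics.Base using (_P_; _P′_)
open import Data.Nat.Combinatorics.Specification using (k!∣nP′k; nP′k≡n!/[n∸k]!; nPk≡n!/[n∸k]!; nP′k≡n[n∸1P′k∸1])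
open import Data.Nat.GCD using (gcd)
open import Data.Nat.Primality using (euclidsLemma; prime⇒nonTrivial)
open import Data.Nat.Induction using (<-rec)
open import Data.Integer using (_⊖_; +≤+)
import Data.Integer as ℤ
import Data.Integer.Properties as ℤP
import Data.Rational.Properties as ℚP
open import Data.Rational.Unnormalised using (mkℚᵘ; *≤*)
import Data.Rational.Unnormalised.Properties as ℚᵘP
open import Data.Product using (_,_)
open import Data.Sum using (inj₁; inj₂)
open import Data.Empty using (⊥-elim)
open import Relation.Nullary using (yes; no)
open import Relation.Binary.PropositionalEquality using (refl; sym; trans; cong; cong₂; subst; module ≡-Reasoning)

C*k!≡P′ : ∀ {n k} → k ≤ n → (n C k) * k ! ≡ n P′ k
C*k!≡P′ {n} {k} k≤n = begin
  (n C k) * k !               ≡⟨ cong (_* k !) (nCk≡nPk/k! k≤n) ⟩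
  ((n P k) / k !) * k !       ≡⟨ cong (λ x → (x / k !) * k !) P≡P′ ⟩
  ((n P′ k) / k !) * k !      ≡⟨ m/n*n≡m (k!∣nP′k k≤n) ⟩
  n P′ k                      ∎
  where
  open ≡-Reasoning
  instance _ = k !≢0
  P≡P′ : n P k ≡ n P′ k
  P≡P′ = trans (nPk≡n!/[n∸k]! k≤n) (sym (nP′k≡n!/[n∸k]! k≤n))

P′-positive : ∀ {n k} → k ≤ n → 1 ≤ n P′ k
P′-positive {n} {zero}  _   = ≤-refl
P′-positive {n} {suc k} k<n = *-mono-≤ (m<n⇒0<n∸m k<n) (P′-positive (<⇒≤ k<n))

C-positive : ∀ {n k} → k ≤ n → 1 ≤ n C k
C-positive {n} {k} k≤n = n≢0⇒n>0 λ C≡0 →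
  <⇒≢ (P′-positive k≤n) (sym (trans (sym (C*k!≡P′ k≤n)) (cong (_* k !) C≡0)))

absorption : ∀ {n k} → k ≤ n → suc k * (suc n C suc k) ≡ suc n * (n C k)
absorption {n} {k} k≤n =
  *-cancelʳ-≡ (suc k * (suc n C suc k)) (suc n * (n C k)) (k !) {{k !≢0}} (begin
  suc k * (suc n C suc k) * k !    ≡⟨ *-assoc (suc k) (suc n C suc k) (k !) ⟩
  suc k * ((suc n C suc k) * k !)  ≡⟨ x∙yz≈y∙xz (suc k) (suc n C suc k) (k !) ⟩
  (suc n C suc k) * suc k !        ≡⟨ C*k!≡P′ (s≤s k≤n) ⟩
  suc n P′ suc k                   ≡⟨ nP′k≡n[n∸1P′k∸1] (suc n) (suc k) ⟩
  suc n * (n P′ k)                 ≡⟨ cong (suc n *_) (C*k!≡P′ k≤n) ⟨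
  suc n * ((n C k) * k !)          ≡⟨ *-assoc (suc n) (n C k) (k !) ⟨
  suc n * (n C k) * k !            ∎)
  where
  open ≡-Reasoning
  open import Algebra.Properties.CommutativeSemigroup *-commutativeSemigroup using (x∙yz≈y∙xz)

prime∤1 : ∀ {p} → Prime p → ¬ p ∣ 1
prime∤1 {p} p-prime p∣1 = <⇒≢ (nonTrivial⇒n>1 p {{prime⇒nonTrivial p-prime}}) (sym (∣1⇒≡1 p∣1))

-- If p ∣ n+1 and k < p, none of the factors n, n-1, …, n-k+1 of n P′ k is a
-- multiple of p (they differ from n+1 by 1, …, k); for a prime p, neither
-- is their product.
prime∤P′ : ∀ {p n k} → Prime p → k < p → p ∣ suc n → ¬ p ∣ n P′ k
prime∤P′ {p} {n} {zero}  p-prime _     _      = prime∤1 p-prime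
prime∤P′ {p} {n} {suc k} p-prime 1+k<p p∣1+n p∣P′ with euclidsLemma (n ∸ k) (n P′ k) p-prime p∣P′
... | inj₂ p∣P′k   = prime∤P′ p-prime (<⇒≤ 1+k<p) p∣1+n p∣P′k
... | inj₁ p∣n∸k   = <⇒≱ 1+k<p (∣⇒≤ (∣m+n∣m⇒∣n p∣[n∸k]+1+k p∣n∸k))
  where
  1+k≤1+n : suc k ≤ suc n
  1+k≤1+n = <⇒≤ (<-≤-trans 1+k<p (∣⇒≤ p∣1+n))
  p∣[n∸k]+1+k : p ∣ (n ∸ k) + suc k
  p∣[n∸k]+1+k = subst (p ∣_) (sym (m∸n+n≡m 1+k≤1+n)) p∣1+n

bernoulli : ∀ c k → k * c + 1 ≤ suc c ^ k
bernoulli c zero    = ≤-refl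
bernoulli c (suc k) = begin
  suc k * c + 1              ≡⟨ +-assoc c (k * c) 1 ⟩
  c + (k * c + 1)            ≤⟨ +-monoʳ-≤ c (bernoulli c k) ⟩
  c + suc c ^ k              ≤⟨ +-monoˡ-≤ (suc c ^ k) (m≤m*n c (suc c ^ k)) ⟩
  c * suc c ^ k + suc c ^ k  ≡⟨ +-comm (c * suc c ^ k) (suc c ^ k) ⟩
  suc c ^ suc k              ∎
  where
  open ≤-Reasoning
  instance _ = m^n≢0 (suc c) k

exponent<power : ∀ c k → k < suc (suc c) ^ k
exponent<power c k = begin-strict
  k                  ≤⟨ m≤m*n k (suc c) ⟩
  k * suc c          <⟨ m<m+n (k * suc c) z<s ⟩
  k * suc c + 1      ≤⟨ bernoulli (suc c) k ⟩
  suc (suc c) ^ k    ∎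
  where open ≤-Reasoning

diff-shift : ∀ a b c → + b ℤ.- + c ≡ + (a + b) ℤ.- + (a + c)
diff-shift a b c = begin
  + b ℤ.- + c                ≡⟨ ℤP.[+m]-[+n]≡m⊖n b c ⟩
  b ⊖ c                      ≡⟨ ℤP.+-cancelˡ-⊖ a b c ⟨
  (a + b) ⊖ (a + c)          ≡⟨ ℤP.[+m]-[+n]≡m⊖n (a + b) (a + c) ⟨
  + (a + b) ℤ.- + (a + c)    ∎
  where open ≡-Reasoning

diff-exchange : ∀ {a b c d} → a + b ≡ c + d → + b ℤ.- + c ≡ + d ℤ.- + a
diff-exchange {a} {b} {c} {d} a+b≡c+d = begin
  + b ℤ.- + c                ≡⟨ diff-shift a b c ⟩
  + (a + b) ℤ.- + (a + c)    ≡⟨ cong₂ (λ x y → + x ℤ.- + y) a+b≡c+d (+-comm a c) ⟩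
  + (c + d) ℤ.- + (c + a)    ≡⟨ diff-shift c d a ⟨
  + d ℤ.- + a                ∎
  where open ≡-Reasoning

scaled-diff-lower-bound : ∀ c o k t → o * k ≤ t →
  ℤ.-1ℤ ℤ.* + t ℤ.≤ (+ c ℤ.- + o) ℤ.* + k
scaled-diff-lower-bound c o k t ok≤t = begin
  ℤ.-1ℤ ℤ.* + t              ≡⟨ ℤP.-1*i≡-i (+ t) ⟩
  ℤ.- + t                    ≤⟨ ℤP.neg-mono-≤ (+≤+ ok≤t) ⟩
  ℤ.- + (o * k)              ≡⟨ cong ℤ.-_ (ℤP.pos-* o k) ⟩
  ℤ.- (+ o ℤ.* + k)          ≡⟨ ℤP.neg-distribˡ-* (+ o) (+ k) ⟩
  (ℤ.- + o) ℤ.* + k          ≤⟨ ℤP.*-monoʳ-≤-nonNeg (+ k) (ℤP.i≤j+i (ℤ.- + o) (+ c)) ⟩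
  (+ c ℤ.- + o) ℤ.* + k      ∎
  where open ℤP.≤-Reasoning

/-≤-cross : ∀ i j a b → i ℤ.* + suc b ℤ.≤ j ℤ.* + suc a → i ℚ./ suc a ℚ.≤ j ℚ./ suc b
/-≤-cross i j a b cross = ℚP.toℚᵘ-cancel-≤
  (ℚᵘP.≤-respˡ-≃ (ℚᵘP.≃-sym (ℚP.toℚᵘ-fromℚᵘ (mkℚᵘ i a)))
    (ℚᵘP.≤-respʳ-≃ (ℚᵘP.≃-sym (ℚP.toℚᵘ-fromℚᵘ (mkℚᵘ j b))) (*≤* cross)))

0≤/ : ∀ a n → 0ℚ ℚ.≤ + a ℚ./ suc n
0≤/ a n = ℚP.nonNegative⁻¹ (+ a ℚ./ suc n) {{ℚP.normalize-nonNeg a (suc n)}}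

module Valuation (q : ℕ) (p-prime : Prime (suc (suc q))) where

  p : ℕ
  p = suc (suc q)

  ordFuel-∤ : ∀ f {n} → ¬ p ∣ n → ordFuel (suc f) p n ≡ 0
  ordFuel-∤ f {n} p∤n with p ∣? n
  ... | yes p∣n = ⊥-elim (p∤n p∣n)
  ... | no  _   = refl

  ordFuel-∣ : ∀ f {n} → p ∣ n → ordFuel (suc f) p n ≡ suc (ordFuel f p (n / p))
  ordFuel-∣ f {n} p∣n with p ∣? n
  ... | yes _   = refl
  ... | no  p∤n = ⊥-elim (p∤n p∣n)

  ordFuel-power : ∀ k {u} f → ¬ p ∣ u → k < f → ordFuel f p (p ^ k * u) ≡ k
  ordFuel-power zero    {u} (suc f) p∤u _ =
    ordFuel-∤ f (λ p∣1u → p∤u (subst (p ∣_) (*-identityˡ u) p∣1u))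
  ordFuel-power (suc k) {u} (suc f) p∤u (s≤s k<f) = begin
    ordFuel (suc f) p (p * p ^ k * u)          ≡⟨ ordFuel-∣ f p∣pᵏ⁺¹u ⟩
    suc (ordFuel f p (p * p ^ k * u / p))      ≡⟨ cong (λ n → suc (ordFuel f p n)) pᵏ⁺¹u/p≡pᵏu ⟩
    suc (ordFuel f p (p ^ k * u))              ≡⟨ cong suc (ordFuel-power k f p∤u k<f) ⟩
    suc k                                      ∎
    where
    open ≡-Reasoning
    pᵏ⁺¹u≡pᵏu*p : p * p ^ k * u ≡ p ^ k * u * p
    pᵏ⁺¹u≡pᵏu*p = trans (*-assoc p (p ^ k) u) (*-comm p (p ^ k * u))
    p∣pᵏ⁺¹u : p ∣ p * p ^ k * u
    p∣pᵏ⁺¹u = divides (p ^ k * u) pᵏ⁺¹u≡pᵏu*p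
    pᵏ⁺¹u/p≡pᵏu : p * p ^ k * u / p ≡ p ^ k * u
    pᵏ⁺¹u/p≡pᵏu = trans (cong (_/ p) pᵏ⁺¹u≡pᵏu*p) (m*n/n≡m (p ^ k * u) p)

  p∤u⇒u≢0 : ∀ {u} → ¬ p ∣ u → NonZero u
  p∤u⇒u≢0 {zero}  p∤0 = ⊥-elim (p∤0 (divides 0 refl))
  p∤u⇒u≢0 {suc u} _   = _

  ordℕ-power : ∀ k {u} → ¬ p ∣ u → ordℕ p (p ^ k * u) ≡ k
  ordℕ-power k {u} p∤u = ordFuel-power k (p ^ k * u) p∤u
    (<-≤-trans (exponent<power q k) (m≤m*n (p ^ k) u {{p∤u⇒u≢0 p∤u}}))

  ordℕ-∤ : ∀ {n} → ¬ p ∣ n → ordℕ p n ≡ 0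
  ordℕ-∤ {zero}  _   = refl
  ordℕ-∤ {suc n} p∤n = ordFuel-∤ n p∤n

  ordℕ-p : ordℕ p p ≡ 1
  ordℕ-p = subst (λ n → ordℕ p n ≡ 1) p¹*1≡p (ordℕ-power 1 (prime∤1 p-prime))
    where
    p¹*1≡p : p ^ 1 * 1 ≡ p
    p¹*1≡p = trans (*-identityʳ (p ^ 1)) (*-identityʳ p)

  record PowerSplit (n : ℕ) : Set where
    constructor split
    field
      exponent   : ℕ
      cofactor   : ℕ
      p∤cofactor : ¬ p ∣ cofactor
      n≡pᵏu      : n ≡ p ^ exponent * cofactor

  power-split : ∀ {n} → 1 ≤ n → PowerSplit n
  power-split {n} = <-rec (λ n → 1 ≤ n → PowerSplit n) step n
    where
    step : ∀ n → (∀ {r} → r < n → 1 ≤ r → PowerSplit r) → 1 ≤ n → PowerSplit n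
    step n rec n≥1 with p ∣? n
    ... | no  p∤n = split 0 n p∤n (sym (*-identityˡ n))
    ... | yes (divides r n≡rp) with rec r<n r≥1
      where
      r≥1 : 1 ≤ r
      r≥1 = n≢0⇒n>0 λ { refl → <⇒≢ n≥1 (sym n≡rp) }
      r<n : r < n
      r<n = subst (r <_) (sym n≡rp) (m<m*n r p {{>-nonZero r≥1}} (s≤s (s≤s z≤n)))
    ... | split k u p∤u r≡pᵏu = split (suc k) u p∤u (begin
      n                  ≡⟨ n≡rp ⟩
      r * p              ≡⟨ cong (_* p) r≡pᵏu ⟩
      p ^ k * u * p      ≡⟨ *-comm (p ^ k * u) p ⟩
      p * (p ^ k * u)    ≡⟨ *-assoc p (p ^ k) u ⟨
      p * p ^ k * u      ∎)
      where open ≡-Reasoning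

  -- ord_p is additive on positive naturals; the p-free parts multiply to a
  -- p-free number because p is prime.
  ordℕ-* : ∀ {a b} → 1 ≤ a → 1 ≤ b → ordℕ p (a * b) ≡ ordℕ p a + ordℕ p b
  ordℕ-* a≥1 b≥1 with power-split a≥1 | power-split b≥1
  ... | split i u p∤u refl | split j v p∤v refl = begin
    ordℕ p (p ^ i * u * (p ^ j * v))        ≡⟨ cong (ordℕ p) regroup ⟩
    ordℕ p (p ^ (i + j) * (u * v))          ≡⟨ ordℕ-power (i + j) p∤uv ⟩
    i + j                                   ≡⟨ cong₂ _+_ (ordℕ-power i p∤u) (ordℕ-power j p∤v) ⟨
    ordℕ p (p ^ i * u) + ordℕ p (p ^ j * v) ∎
    where
    open ≡-Reasoning
    p∤uv : ¬ p ∣ u * v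
    p∤uv p∣uv with euclidsLemma u v p-prime p∣uv
    ... | inj₁ p∣u = p∤u p∣u
    ... | inj₂ p∣v = p∤v p∣v
    regroup : p ^ i * u * (p ^ j * v) ≡ p ^ (i + j) * (u * v)
    regroup = trans ([m*n]*[o*p]≡[m*o]*[n*p] (p ^ i) u (p ^ j) v)
                    (cong (_* (u * v)) (sym (^-distribˡ-+-* p i j)))

  -- p^ord_p(n) ∣ n, so p^ord_p(n) ≤ n; with Bernoulli, ord_p(n)·(p-1) < n.
  ordℕ-bound : ∀ {n} → 1 ≤ n → ordℕ p n * suc q < n
  ordℕ-bound n≥1 with power-split n≥1
  ... | split k u p∤u refl = begin-strict
    ordℕ p (p ^ k * u) * suc q        ≡⟨ cong (_* suc q) (ordℕ-power k p∤u) ⟩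
    k * suc q                         <⟨ m<m+n (k * suc q) z<s ⟩
    k * suc q + 1                     ≤⟨ bernoulli (suc q) k ⟩
    p ^ k                             ≤⟨ m≤m*n (p ^ k) u {{p∤u⇒u≢0 p∤u}} ⟩
    p ^ k * u                         ∎
    where open ≤-Reasoning

  ordℕ-factor : ∀ {x g n} → x * g ≡ n → 1 ≤ n → ordℕ p g + ordℕ p x ≡ ordℕ p n
  ordℕ-factor {x} {g} refl xg≥1 = trans (+-comm (ordℕ p g) (ordℕ p x)) (sym (ordℕ-* x≥1 g≥1))
    where
    x≥1 : 1 ≤ x
    x≥1 = n≢0⇒n>0 λ x≡0 → <⇒≢ xg≥1 (sym (cong (_* g) x≡0))
    g≥1 : 1 ≤ g
    g≥1 = n≢0⇒n>0 λ g≡0 → <⇒≢ xg≥1 (sym (trans (cong (x *_) g≡0) (*-zeroʳ x)))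

  -- ord_p (a/b) = ord_p a - ord_p b: reducing a/b divides a and b by their
  -- gcd g, which lowers both valuations by ord_p g.
  ord-/ : ∀ {a} b → 1 ≤ a → ord p (+ a ℚ./ suc b) ≡ + ordℕ p a ℤ.- + ordℕ p (suc b)
  ord-/ {a} b a≥1 = begin
    + ordℕ p N ℤ.- + ordℕ p D
      ≡⟨ diff-shift (ordℕ p g) (ordℕ p N) (ordℕ p D) ⟩
    + (ordℕ p g + ordℕ p N) ℤ.- + (ordℕ p g + ordℕ p D)
      ≡⟨ cong₂ (λ x y → + x ℤ.- + y) (ordℕ-factor {N} {g} N*g≡a a≥1)
                                     (ordℕ-factor {D} {g} D*g≡1+b (s≤s z≤n)) ⟩
    + ordℕ p a ℤ.- + ordℕ p (suc b)
      ∎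
    where
    open ≡-Reasoning
    r = + a ℚ./ suc b
    g = gcd a (suc b)
    N = ℤ.∣ ℚ.↥ r ∣
    D = ℚ.↧ₙ r
    N*g≡a : N * g ≡ a
    N*g≡a = trans (sym (ℤP.∣i*j∣≡∣i∣*∣j∣ (ℚ.↥ r) (+ g))) (cong ℤ.∣_∣ (ℚP.↥-/ (+ a) (suc b)))
    D*g≡1+b : D * g ≡ suc b
    D*g≡1+b = trans (sym (ℤP.∣i*j∣≡∣i∣*∣j∣ (ℚ.↧ r) (+ g))) (cong ℤ.∣_∣ (ℚP.↧-/ (+ a) (suc b)))

  ord-binomial-ratio : ∀ {n k} → k ≤ n →
    ord p (+ (suc n C suc k) ℚ./ suc n) ≡ + ordℕ p (n C k) ℤ.- + ordℕ p (suc k)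
  ord-binomial-ratio {n} {k} k≤n =
    trans (ord-/ n (C-positive (s≤s k≤n)))
          (diff-exchange {ordℕ p (suc k)} {ordℕ p (suc n C suc k)} valuations)
    where
    open ≡-Reasoning
    valuations : ordℕ p (suc k) + ordℕ p (suc n C suc k) ≡ ordℕ p (suc n) + ordℕ p (n C k)
    valuations = begin
      ordℕ p (suc k) + ordℕ p (suc n C suc k)   ≡⟨ ordℕ-* (s≤s z≤n) (C-positive (s≤s k≤n)) ⟨
      ordℕ p (suc k * (suc n C suc k))          ≡⟨ cong (ordℕ p) (absorption k≤n) ⟩
      ordℕ p (suc n * (n C k))                  ≡⟨ ordℕ-* (s≤s z≤n) (C-positive k≤n) ⟩
      ordℕ p (suc n) + ordℕ p (n C k)           ∎

  ratio-lower-bound : ∀ {n t} → suc t ≤ n →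
    - ((+ 1) /' (p ∸ 1)) ℚ.≤ ord p (+ (suc n C suc (suc t)) ℚ./ suc n) /' suc t
  ratio-lower-bound {n} {t} 1+t≤n =
    subst (λ v → - ((+ 1) /' (p ∸ 1)) ℚ.≤ v ℚ./ suc t) (sym (ord-binomial-ratio 1+t≤n))
      (/-≤-cross ℤ.-1ℤ (+ c ℤ.- + o) q t (scaled-diff-lower-bound c o (suc q) (suc t) o[p-1]≤s-1))
    where
    c = ordℕ p (n C suc t)
    o = ordℕ p (suc (suc t))
    o[p-1]≤s-1 : o * suc q ≤ suc t
    o[p-1]≤s-1 = ≤-pred (ordℕ-bound (s≤s z≤n))

  -- If p ∤ m, no p is left in the denominator of C(m,k)/m.
  ratio-nonneg : ∀ {n k} → k ≤ suc n → ¬ p ∣ suc n → ∀ d →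
    0ℚ ℚ.≤ ord p (+ (suc n C k) ℚ./ suc n) /' suc d
  ratio-nonneg {n} {k} k≤1+n p∤1+n d =
    subst (λ v → 0ℚ ℚ.≤ v ℚ./ suc d) (sym ord≡ordC) (0≤/ (ordℕ p (suc n C k)) d)
    where
    open ≡-Reasoning
    ord≡ordC : ord p (+ (suc n C k) ℚ./ suc n) ≡ + ordℕ p (suc n C k)
    ord≡ordC = begin
      ord p (+ (suc n C k) ℚ./ suc n)             ≡⟨ ord-/ n (C-positive k≤1+n) ⟩
      + ordℕ p (suc n C k) ℤ.- + ordℕ p (suc n)   ≡⟨ cong (λ o → + ordℕ p (suc n C k) ℤ.- + o) (ordℕ-∤ p∤1+n) ⟩
      + ordℕ p (suc n C k) ℤ.- + 0                ≡⟨ ℤP.+-identityʳ (+ ordℕ p (suc n C k)) ⟩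
      + ordℕ p (suc n C k)                        ∎

  ratio-at-m : ∀ n → ¬ p ∣ suc (suc n) →
    ord p (+ (suc (suc n) C suc (suc n)) ℚ./ suc (suc n)) /' suc n ≡ 0ℚ
  ratio-at-m n p∤m = begin
    ord p (+ (m C m) ℚ./ m) ℚ./ suc n          ≡⟨ cong (λ c → ord p (+ c ℚ./ m) ℚ./ suc n) (nCn≡1 m) ⟩
    ord p (+ 1 ℚ./ m) ℚ./ suc n                ≡⟨ cong (ℚ._/ suc n) (ord-/ {1} (suc n) (s≤s z≤n)) ⟩
    (+ ordℕ p 1 ℤ.- + ordℕ p m) ℚ./ suc n      ≡⟨ cong₂ (λ a b → (+ a ℤ.- + b) ℚ./ suc n)
                                                    (ordℕ-∤ {1} (prime∤1 p-prime)) (ordℕ-∤ {m} p∤m) ⟩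
    ℤ.0ℤ ℚ./ suc n                             ≡⟨ ℚP.0/n≡0 (suc n) ⟩
    0ℚ                                         ∎
    where
    open ≡-Reasoning
    m = suc (suc n)

  -- If p ∣ m, then p ∤ C(m-1,p-1), so ord_p (C(m,p)/m) = -ord_p p = -1.
  ratio-at-p : ∀ {n} → p ∣ suc n →
    ord p (+ (suc n C p) ℚ./ suc n) /' (p ∸ 1) ≡ - ((+ 1) /' (p ∸ 1))
  ratio-at-p {n} p∣m = cong (ℚ._/ suc q) (begin
    ord p (+ (suc n C p) ℚ./ suc n)             ≡⟨ ord-binomial-ratio 1+q≤n ⟩
    + ordℕ p (n C suc q) ℤ.- + ordℕ p p         ≡⟨ cong₂ (λ a b → + a ℤ.- + b) (ordℕ-∤ p∤C) ordℕ-p ⟩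
    ℤ.-1ℤ                                       ∎)
    where
    open ≡-Reasoning
    1+q≤n : suc q ≤ n
    1+q≤n = ≤-pred (∣⇒≤ p∣m)
    p∤C : ¬ p ∣ n C suc q
    p∤C p∣C = prime∤P′ p-prime ≤-refl p∣m (subst (p ∣_) (C*k!≡P′ 1+q≤n) (∣m⇒∣m*n (suc q !) p∣C))

from-two : {P : ℕ → Set} → (∀ t → P (suc (suc t))) → ∀ s → 2 ≤ s → P s
from-two claim (suc (suc t)) (s≤s (s≤s z≤n)) = claim t

lemma4p1 : (p m : ℕ) → Prime p → 2 ≤ m →
    ((¬ (p ∣ m)) →
      ((s : ℕ) → 2 ≤ s → s ≤ m → 0ℚ ℚ.≤ (ord p ((+ (m C s)) /' m) /' (s ∸ 1)))
      × (ord p ((+ (m C m)) /' m) /' (m ∸ 1) ≡ 0ℚ))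
    × (p ∣ m →
      ((s : ℕ) → 2 ≤ s → s ≤ m → (- ((+ 1) /' (p ∸ 1))) ℚ.≤ (ord p ((+ (m C s)) /' m) /' (s ∸ 1)))
      × (ord p ((+ (m C p)) /' m) /' (p ∸ 1) ≡ - ((+ 1) /' (p ∸ 1))))
lemma4p1 (suc (suc q)) (suc (suc n)) p-prime (s≤s (s≤s z≤n)) =
    (λ p∤m → from-two (λ t s≤m → ratio-nonneg s≤m p∤m t) , ratio-at-m n p∤m)
  , (λ p∣m → from-two (λ t s≤m → ratio-lower-bound (≤-pred s≤m)) , ratio-at-p p∣m)
  where open Valuation q p-prime
lemma4p1 0       _ p-prime _ with prime⇒nonTrivial p-prime
... | ()
lemma4p1 1       _ p-prime _ with prime⇒nonTrivial p-prime
... | ()
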